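{- Let $\varphi$ be an LTL formula in negation normal form with $n$ proper subformulas. Then $\mathit{Reach}^\vee(\varphi)$ has at most $2^n$ elements, and consequently each of the nondeterministic Büchi automata $\mathcal{A}_\mu^\varphi$, $\mathcal{A}_{\mathbf{GF}\mu}^\varphi$ (for $\varphi\in\mu LTL$) and $\mathcal{A}_\nu^\varphi$, $\mathcal{A}_{\mathbf{FG}\nu}^\varphi$ (for $\varphi\in\nu LTL$) has at most $2^{n+1}+1 = O(2^n)$ states.
   Context: LTL formulas in negation normal form over a finite set $Ap$: $\varphi ::= \mathbf{tt} \mid \mathbf{ff} \mid a \mid \neg a \mid \varphi\wedge\varphi \mid \varphi\vee\varphi \mid \mathbf{X}\varphi \mid \mathbf{F}\varphi \mid \mathbf{G}\varphi \mid \varphi\mathbf{U}\varphi \mid \varphi\mathbf{W}\varphi \mid \varphi\mathbf{M}\varphi \mid \varphi\mathbf{R}\varphi$. $\mu LTL$: fragment using only $\mathbf{tt},\mathbf{ff},a,\neg a,\wedge,\vee,\mathbf{X},\mathbf{F},\mathbf{U},\mathbf{M}$; $\nu LTL$: fragment using only $\mathbf{tt},\mathbf{ff},a,\neg a,\wedge,\vee,\mathbf{X},\mathbf{G},\mathbf{W},\mathbf{R}$. A subformula is proper if its top symbol is not $\wedge$ or $\vee$. $\varphi\equiv_P\psi$ (propositional equivalence) if, after replacing every maximal proper subformula $\chi$ by a propositional variable $x_\chi$, the resulting propositional formulas are equivalent. The function $\mathit{af}$: for a letter $\nu\in 2^{Ap}$, $\mathit{af}(a,\nu)=\mathbf{tt}$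 if $a\in\nu$ else $\mathbf{ff}$; $\mathit{af}(\neg a,\nu)=\mathbf{ff}$ if $a\in\nu$ else $\mathbf{tt}$; $\mathit{af}(\mathbf{tt},\nu)=\mathbf{tt}$, $\mathit{af}(\mathbf{ff},\nu)=\mathbf{ff}$; $\mathit{af}$ commutes with $\wedge,\vee$; $\mathit{af}(\mathbf{X}\varphi,\nu)=\varphi$; $\mathit{af}(\mathbf{F}\varphi,\nu)=\mathit{af}(\varphi,\nu)\vee\mathbf{F}\varphi$; $\mathit{af}(\mathbf{G}\varphi,\nu)=\mathit{af}(\varphi,\nu)\wedge\mathbf{G}\varphi$; $\mathit{af}(\varphi\mathbf{U}\psi,\nu)=\mathit{af}(\psi,\nu)\vee(\mathit{af}(\varphi,\nu)\wedge\varphi\mathbf{U}\psi)$, same shape for $\mathbf{W}$; $\mathit{af}(\varphi\mathbf{M}\psi,\nu)=\mathit{af}(\psi,\nu)\wedge(\mathit{af}(\varphi,\nu)\vee\varphi\mathbf{M}\psi)$, same shape for $\mathbf{R}$. $\mathit{dnf}(\psi)$ is the set of clauses (conjunctions of proper subformulas, up to $\equiv_P$) of a disjunctive normal form of the propositional abstraction of $\psi$, with $\mathit{dnf}(\mathbf{ff})=\emptyset$, $\mathit{dnf}(\mathbf{tt})=\{\mathbf{tt}\}$. $\mathit{af}^\vee(\psi,\epsilon)=\mathit{dnf}(\psi)$, $\mathit{af}^\vee(\psi,\nu)=\mathit{dnf}(\mathit{af}(\psi,\nu))$, $\mathit{af}^\vee(\psi,\nu u)=\bigcup_{\psi'\in\mathit{af}^\vee(\psi,\nu)}\mathit{af}^\vee(\psi',u)$,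 $\mathit{Reach}^\vee(\varphi)=\bigcup_{u\in(2^{Ap})^*}\mathit{af}^\vee(\varphi,u)$. The automata: $\mathcal{A}_\mu^\varphi$ and $\mathcal{A}_\nu^\varphi$ have state set $\mathit{Reach}^\vee(\varphi)$; $\mathcal{A}_{\mathbf{GF}\mu}^\varphi$ has state set $\mathit{Reach}^\vee(\mathbf{F}\varphi)$; $\mathcal{A}_{\mathbf{FG}\nu}^\varphi$ has state set $\mathit{Reach}^\vee(\mathbf{G}\varphi)\cup\{\mathbf{F}\mathbf{G}\varphi\}$ (transitions are given by $\mathit{af}^\vee$ with modifications irrelevant to the state count). -}

module Defs where

open import Data.Nat using (ℕ; _≤_; _+_; _^_)
open import Data.Fin using (Fin)
open import Data.Bool using (Bool; true; false; _∧_; _∨_)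
open import Data.List using (List; []; _∷_; _++_; concatMap; length; [_]; map)
open import Data.List.Relation.Unary.All using (All)
open import Data.List.Relation.Unary.Any using (Any)
open import Data.List.Relation.Unary.AllPairs using (AllPairs)
open import Data.Product using (_×_; ∃)
open import Data.Sum using (_⊎_)
open import Data.Empty using (⊥)
open import Data.Unit using (⊤)
open import Relation.Nullary using (¬_)
open import Relation.Binary.PropositionalEquality using (_≡_)

data LTL (k : ℕ) : Set where
  tt ff    : LTL k
  atom     : Fin k → LTL k
  natom    : Fin k → LTL k
  _∧ᴸ_ _∨ᴸ_ : LTL k → LTL k → LTL k
  X F G    : LTL k → LTL k
  _U_ _W_ _M_ _R_ : LTL k → LTL k → LTL k

Letter : ℕ → Set
Letter k = Fin k → Bool

Word : ℕ → Set
Word k = List (Letter k)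

Proper : ∀ {k} → LTL k → Set
Proper (φ ∧ᴸ ψ) = ⊥
Proper (φ ∨ᴸ ψ) = ⊥
Proper _ = ⊤

data _⊑_ {k} (χ : LTL k) : LTL k → Set where
  here : χ ⊑ χ
  ∧ˡ : ∀ {φ ψ} → χ ⊑ φ → χ ⊑ (φ ∧ᴸ ψ)
  ∧ʳ : ∀ {φ ψ} → χ ⊑ ψ → χ ⊑ (φ ∧ᴸ ψ)
  ∨ˡ : ∀ {φ ψ} → χ ⊑ φ → χ ⊑ (φ ∨ᴸ ψ)
  ∨ʳ : ∀ {φ ψ} → χ ⊑ ψ → χ ⊑ (φ ∨ᴸ ψ)
  inX : ∀ {φ} → χ ⊑ φ → χ ⊑ X φ
  inF : ∀ {φ} → χ ⊑ φ → χ ⊑ F φ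
  inG : ∀ {φ} → χ ⊑ φ → χ ⊑ G φ
  Uˡ : ∀ {φ ψ} → χ ⊑ φ → χ ⊑ (φ U ψ)
  Uʳ : ∀ {φ ψ} → χ ⊑ ψ → χ ⊑ (φ U ψ)
  Wˡ : ∀ {φ ψ} → χ ⊑ φ → χ ⊑ (φ W ψ)
  Wʳ : ∀ {φ ψ} → χ ⊑ ψ → χ ⊑ (φ W ψ)
  Mˡ : ∀ {φ ψ} → χ ⊑ φ → χ ⊑ (φ M ψ)
  Mʳ : ∀ {φ ψ} → χ ⊑ ψ → χ ⊑ (φ M ψ)
  Rˡ : ∀ {φ ψ} → χ ⊑ φ → χ ⊑ (φ R ψ)
  Rʳ : ∀ {φ ψ} → χ ⊑ ψ → χ ⊑ (φ R ψ)

ProperSub : ∀ {k} → LTL k → LTL k → Set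
ProperSub χ φ = χ ⊑ φ × Proper χ

data IsMu {k} : LTL k → Set where
  tt : IsMu tt
  ff : IsMu ff
  atom : ∀ a → IsMu (atom a)
  natom : ∀ a → IsMu (natom a)
  and : ∀ {φ ψ} → IsMu φ → IsMu ψ → IsMu (φ ∧ᴸ ψ)
  or : ∀ {φ ψ} → IsMu φ → IsMu ψ → IsMu (φ ∨ᴸ ψ)
  next : ∀ {φ} → IsMu φ → IsMu (X φ)
  fin : ∀ {φ} → IsMu φ → IsMu (F φ)
  until : ∀ {φ ψ} → IsMu φ → IsMu ψ → IsMu (φ U ψ)
  strongRel : ∀ {φ ψ} → IsMu φ → IsMu ψ → IsMu (φ M ψ)

data IsNu {k} : LTL k → Set where
  tt : IsNu tt
  ff : IsNu ff
  atom : ∀ a → IsNu (atom a)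
  natom : ∀ a → IsNu (natom a)
  and : ∀ {φ ψ} → IsNu φ → IsNu ψ → IsNu (φ ∧ᴸ ψ)
  or : ∀ {φ ψ} → IsNu φ → IsNu ψ → IsNu (φ ∨ᴸ ψ)
  next : ∀ {φ} → IsNu φ → IsNu (X φ)
  glob : ∀ {φ} → IsNu φ → IsNu (G φ)
  weakUntil : ∀ {φ ψ} → IsNu φ → IsNu ψ → IsNu (φ W ψ)
  release : ∀ {φ ψ} → IsNu φ → IsNu ψ → IsNu (φ R ψ)

-- propositional equivalence: every maximal proper subformula χ becomes
-- an independent propositional variable x_χ (tt / ff stay constants)

evalP : ∀ {k} → (LTL k → Bool) → LTL k → Bool
evalP σ tt = true
evalP σ ff = false
evalP σ (φ ∧ᴸ ψ) = evalP σ φ ∧ evalP σ ψ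
evalP σ (φ ∨ᴸ ψ) = evalP σ φ ∨ evalP σ ψ
evalP σ χ = σ χ

_≡P_ : ∀ {k} → LTL k → LTL k → Set
φ ≡P ψ = ∀ σ → evalP σ φ ≡ evalP σ ψ

af : ∀ {k} → LTL k → Letter k → LTL k
af tt ν = tt
af ff ν = ff
af (atom a) ν with ν a
... | true = tt
... | false = ff
af (natom a) ν with ν a
... | true = ff
... | false = tt
af (φ ∧ᴸ ψ) ν = af φ ν ∧ᴸ af ψ ν
af (φ ∨ᴸ ψ) ν = af φ ν ∨ᴸ af ψ ν
af (X φ) ν = φ
af (F φ) ν = af φ ν ∨ᴸ F φ
af (G φ) ν = af φ ν ∧ᴸ G φ
af (φ U ψ) ν = af ψ ν ∨ᴸ (af φ ν ∧ᴸ (φ U ψ))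
af (φ W ψ) ν = af ψ ν ∨ᴸ (af φ ν ∧ᴸ (φ W ψ))
af (φ M ψ) ν = af ψ ν ∧ᴸ (af φ ν ∨ᴸ (φ M ψ))
af (φ R ψ) ν = af ψ ν ∧ᴸ (af φ ν ∨ᴸ (φ R ψ))

-- dnf: clauses (lists of proper subformulas, the empty clause being tt)
-- of the disjunctive normal form of the propositional abstraction

conj : ∀ {k} → List (LTL k) → LTL k
conj [] = tt
conj (χ ∷ c) = χ ∧ᴸ conj c

dnfC : ∀ {k} → LTL k → List (List (LTL k))
dnfC tt = [ [] ]
dnfC ff = []
dnfC (φ ∧ᴸ ψ) = concatMap (λ c → concatMap (λ d → [ c ++ d ]) (dnfC ψ)) (dnfC φ)
dnfC (φ ∨ᴸ ψ) = dnfC φ ++ dnfC ψ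
dnfC χ = [ [ χ ] ]

dnf : ∀ {k} → LTL k → List (LTL k)
dnf φ = map conj (dnfC φ)

af∨ : ∀ {k} → LTL k → Word k → List (LTL k)
af∨ ψ [] = dnf ψ
af∨ ψ (ν ∷ []) = dnf (af ψ ν)
af∨ ψ (ν ∷ ν′ ∷ u) = concatMap (λ ψ′ → af∨ ψ′ (ν′ ∷ u)) (dnf (af ψ ν))

-- membership in Reach^∨(φ) (elements are taken up to ≡P)
Reach∨ : ∀ {k} → LTL k → LTL k → Set
Reach∨ φ ψ = ∃ λ (u : Word _) → Any (ψ ≡P_) (af∨ φ u)

-- cardinality bound for a set of formulas considered up to ≡P:
-- every list of pairwise ≡P-inequivalent members has length ≤ b

CardLe : ∀ {k} → (LTL k → Set) → ℕ → Set
CardLe {k} S b = (cs : List (LTL k)) → All S cs →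
  AllPairs (λ x y → ¬ (x ≡P y)) cs → length cs ≤ b

StatesAμ StatesAν StatesAGFμ StatesAFGν : ∀ {k} → LTL k → LTL k → Set
StatesAμ φ = Reach∨ φ
StatesAν φ = Reach∨ φ
StatesAGFμ φ = Reach∨ (F φ)
StatesAFGν φ ψ = Reach∨ (G φ) ψ ⊎ (ψ ≡P F (G φ))

-- Every formula reached by af∨ from φ is a conjunction of proper subformulas of φ, since af and dnf
-- never leave the positive Boolean combinations of subformulas of φ. Up to ≡P such a conjunction is
-- determined by its set of conjuncts, a subset of the n proper subformulas, so the reachable formulas
-- inject modulo ≡P into Fin (2 ^ n), and the pigeonhole principle bounds every ≡P-distinct family.
-- The automata only add F φ (resp. G φ) to the proper subformulas and, for 𝒜_FGν, the state FGφ.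
module Submission where

open import Defs
open import Data.Nat using (ℕ; suc; _≤_; _+_; _^_; _≤?_)
open import Data.Nat.Properties using (≤-trans; ≤-reflexive; ≰⇒>; m≤m+n; +-comm)
open import Data.Fin using (Fin; zero; suc; join; splitAt; inject≤; funToFin; finToFun)
open import Data.Fin.Patterns using (0F; 1F)
open import Data.Fin.Properties using (pigeonhole; <⇒≢; inject≤-injective; splitAt-join; finToFun-funToFin)
  renaming (_≟_ to _≟ᶠ_)
open import Data.Bool using (true; false; T)
open import Data.Bool.Properties using (T-∧)
open import Data.List using (List; []; _∷_; length; lookup; map; concatMap)
open import Data.List.Membership.Propositional using (_∈_)
open import Data.List.Membership.Propositional.Properties using (∈-lookup)
open import Data.List.Relation.Binary.Subset.Propositional using (_⊆_)
import Data.List.Relation.Binary.Subset.Propositional.Properties as Subset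
open import Data.List.Relation.Unary.All as All using (All; []; _∷_; lookupAny)
open import Data.List.Relation.Unary.All.Properties using (anti-mono; concat⁺; map⁺; ++⁺)
open import Data.List.Relation.Unary.AllPairs using (AllPairs; []; _∷_)
open import Data.List.Relation.Unary.Any using (here; there; index; any?)
open import Data.List.Relation.Unary.Any.Properties using (lookup-index)
open import Data.List.Relation.Unary.Unique.Propositional using (Unique)
open import Data.Product using (_×_; _,_; ∃; proj₁)
open import Data.Sum as Sum using (_⊎_; inj₁; inj₂)
open import Data.Sum.Properties using (inj₁-injective; inj₂-injective)
open import Data.Unit using (⊤; tt)
open import Data.Empty using (⊥-elim)
open import Function using (_∘_)
open import Function.Bundles using (_⇔_; Equivalence)
open import Relation.Nullary using (¬_; Dec; yes; no; contradiction)
open import Relation.Binary.PropositionalEquality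
  using (_≡_; _≢_; _≗_; refl; sym; trans; cong; cong₂; subst; subst₂; module ≡-Reasoning)

lookup-injective : ∀ {A : Set} {xs : List A} → AllPairs _≢_ xs →
  ∀ i j → lookup xs i ≡ lookup xs j → i ≡ j
lookup-injective (_    ∷ _)     zero    zero    _  = refl
lookup-injective (x≢xs ∷ _)     zero    (suc j) eq = contradiction eq (All.lookup x≢xs (∈-lookup j))
lookup-injective (x≢xs ∷ _)     (suc i) zero    eq = contradiction (sym eq) (All.lookup x≢xs (∈-lookup i))
lookup-injective (_    ∷ xs≢xs) (suc i) (suc j) eq = cong suc (lookup-injective xs≢xs i j eq)

distinct-length≤ : ∀ {N} {xs : List (Fin N)} → AllPairs _≢_ xs → length xs ≤ N
distinct-length≤ {N} {xs} distinct with length xs ≤? N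
... | yes len≤N = len≤N
... | no len≰N =
  let i , j , i<j , same = pigeonhole (≰⇒> len≰N) (lookup xs)
  in contradiction (lookup-injective distinct i j same) (<⇒≢ i<j)

funToFin-injective : ∀ {m n} (f g : Fin m → Fin n) → funToFin f ≡ funToFin g → f ≗ g
funToFin-injective f g eq i = begin
  f i                      ≡⟨ sym (finToFun-funToFin f i) ⟩
  finToFun (funToFin f) i  ≡⟨ cong (λ c → finToFun c i) eq ⟩
  finToFun (funToFin g) i  ≡⟨ finToFun-funToFin g i ⟩
  g i                      ∎
  where open ≡-Reasoning

bit : ∀ {A : Set} → Dec A → Fin 2
bit (yes _) = 1F
bit (no _)  = 0F

indicator : ∀ {n} → List (Fin n) → Fin n → Fin 2
indicator is i = bit (any? (i ≟ᶠ_) is)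

indicator-⊆ : ∀ {n} {is js : List (Fin n)} → indicator is ≗ indicator js → is ⊆ js
indicator-⊆ {is = is} {js} same {i} i∈is with any? (i ≟ᶠ_) is | any? (i ≟ᶠ_) js | same i
... | _         | yes i∈js | _ = i∈js
... | no i∉is   | no _     | _ = contradiction i∈is i∉is
... | yes _     | no _     | ()

All-concatMap : ∀ {A B : Set} {P : A → Set} {Q : B → Set} {f : A → List B} {xs} →
  (∀ {x} → P x → All Q (f x)) → All P xs → All Q (concatMap f xs)
All-concatMap g = concat⁺ ∘ map⁺ ∘ All.map g

T-injective : ∀ {a b} → (T a → T b) → (T b → T a) → a ≡ b
T-injective {false} {false} _   _   = refl
T-injective {false} {true}  _   b⇒a = ⊥-elim (b⇒a tt)
T-injective {true}  {false} a⇒b _   = ⊥-elim (a⇒b tt)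
T-injective {true}  {true}  _   _   = refl

module _ {k : ℕ} where

  T-conj⁺ : ∀ σ (c : List (LTL k)) → All (T ∘ evalP σ) c → T (evalP σ (conj c))
  T-conj⁺ σ []      []       = tt
  T-conj⁺ σ (χ ∷ c) (t ∷ ts) = Equivalence.from T-∧ (t , T-conj⁺ σ c ts)

  T-conj⁻ : ∀ σ (c : List (LTL k)) → T (evalP σ (conj c)) → All (T ∘ evalP σ) c
  T-conj⁻ σ []      _ = []
  T-conj⁻ σ (χ ∷ c) t = let tχ , tc = Equivalence.to T-∧ t in tχ ∷ T-conj⁻ σ c tc

  conj-anti-mono : ∀ {c d : List (LTL k)} → c ⊆ d →
    ∀ σ → T (evalP σ (conj d)) → T (evalP σ (conj c))
  conj-anti-mono c⊆d σ = T-conj⁺ σ _ ∘ anti-mono c⊆d ∘ T-conj⁻ σ _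

  conj-cong : ∀ {c d : List (LTL k)} → c ⊆ d → d ⊆ c → conj c ≡P conj d
  conj-cong c⊆d d⊆c σ = T-injective (conj-anti-mono d⊆c σ) (conj-anti-mono c⊆d σ)

  record Coding (S : LTL k → Set) (N : ℕ) : Set where
    field
      code           : ∀ {θ} → S θ → Fin N
      code-injective : ∀ {θ θ′} (s : S θ) (s′ : S θ′) → code s ≡ code s′ → θ ≡P θ′

  open Coding

  Coding⇒CardLe : ∀ {S n} → Coding S n → CardLe S n
  Coding⇒CardLe {S} {n} C cs ss distinct =
    ≤-trans (≤-reflexive (sym (length-codes ss))) (distinct-length≤ (codes-distinct ss distinct))
    where
    codes : ∀ {cs} → All S cs → List (Fin n)
    codes []       = []
    codes (s ∷ ss) = code C s ∷ codes ss

    length-codes : ∀ {cs} (ss : All S cs) → length (codes ss) ≡ length cs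
    length-codes []       = refl
    length-codes (_ ∷ ss) = cong suc (length-codes ss)

    fresh : ∀ {θ cs} (s : S θ) (ss : All S cs) →
      All (λ θ′ → ¬ θ ≡P θ′) cs → All (code C s ≢_) (codes ss)
    fresh s []        []        = []
    fresh s (s′ ∷ ss) (θ≢ ∷ θ≢s) = θ≢ ∘ code-injective C s s′ ∷ fresh s ss θ≢s

    codes-distinct : ∀ {cs} (ss : All S cs) →
      AllPairs (λ θ θ′ → ¬ θ ≡P θ′) cs → AllPairs _≢_ (codes ss)
    codes-distinct []       []         = []
    codes-distinct (s ∷ ss) (θ≢ ∷ dist) = fresh s ss θ≢ ∷ codes-distinct ss dist

  Coding-≤ : ∀ {S m n} → m ≤ n → Coding S m → Coding S n
  Coding-≤ m≤n C .code s = inject≤ (code C s) m≤n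
  Coding-≤ m≤n C .code-injective s s′ eq =
    code-injective C s s′ (inject≤-injective m≤n m≤n (code C s) (code C s′) eq)

  Coding-∪ : ∀ {S S′ m n} → Coding S m → Coding S′ n → Coding (λ θ → S θ ⊎ S′ θ) (m + n)
  Coding-∪ {S} {S′} {m} {n} C C′ = record
    { code           = join m n ∘ tag
    ; code-injective = λ s s′ → tag-injective s s′ ∘ join-injective (tag s) (tag s′)
    }
    where
    tag : ∀ {θ} → S θ ⊎ S′ θ → Fin m ⊎ Fin n
    tag = Sum.map (code C) (code C′)

    tag-injective : ∀ {θ θ′} s s′ → tag {θ} s ≡ tag {θ′} s′ → θ ≡P θ′
    tag-injective (inj₁ s) (inj₁ s′) eq = code-injective C  s s′ (inj₁-injective eq)
    tag-injective (inj₂ s) (inj₂ s′) eq = code-injective C′ s s′ (inj₂-injective eq)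
    tag-injective (inj₁ _) (inj₂ _) ()
    tag-injective (inj₂ _) (inj₁ _) ()

    join-injective : ∀ x y → join m n x ≡ join m n y → x ≡ y
    join-injective x y eq =
      trans (sym (splitAt-join m n x)) (trans (cong (splitAt m) eq) (splitAt-join m n y))

  Coding-⊆ : ∀ {S S′ n} → (∀ θ → S θ → S′ θ) → Coding S′ n → Coding S n
  Coding-⊆ S⊆S′ C .code {θ} = code C ∘ S⊆S′ θ
  Coding-⊆ S⊆S′ C .code-injective {θ} {θ′} s s′ = code-injective C (S⊆S′ θ s) (S⊆S′ θ′ s′)

  Coding-≡P : ∀ ψ → Coding (_≡P ψ) 1
  Coding-≡P ψ .code _ = zero
  Coding-≡P ψ .code-injective θ≡ψ θ′≡ψ _ σ = trans (θ≡ψ σ) (sym (θ′≡ψ σ))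

  ⊑-trans : {χ ψ φ : LTL k} → χ ⊑ ψ → ψ ⊑ φ → χ ⊑ φ
  ⊑-trans χ⊑ψ here    = χ⊑ψ
  ⊑-trans χ⊑ψ (∧ˡ p) = ∧ˡ (⊑-trans χ⊑ψ p)
  ⊑-trans χ⊑ψ (∧ʳ p) = ∧ʳ (⊑-trans χ⊑ψ p)
  ⊑-trans χ⊑ψ (∨ˡ p) = ∨ˡ (⊑-trans χ⊑ψ p)
  ⊑-trans χ⊑ψ (∨ʳ p) = ∨ʳ (⊑-trans χ⊑ψ p)
  ⊑-trans χ⊑ψ (inX p) = inX (⊑-trans χ⊑ψ p)
  ⊑-trans χ⊑ψ (inF p) = inF (⊑-trans χ⊑ψ p)
  ⊑-trans χ⊑ψ (inG p) = inG (⊑-trans χ⊑ψ p)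
  ⊑-trans χ⊑ψ (Uˡ p) = Uˡ (⊑-trans χ⊑ψ p)
  ⊑-trans χ⊑ψ (Uʳ p) = Uʳ (⊑-trans χ⊑ψ p)
  ⊑-trans χ⊑ψ (Wˡ p) = Wˡ (⊑-trans χ⊑ψ p)
  ⊑-trans χ⊑ψ (Wʳ p) = Wʳ (⊑-trans χ⊑ψ p)
  ⊑-trans χ⊑ψ (Mˡ p) = Mˡ (⊑-trans χ⊑ψ p)
  ⊑-trans χ⊑ψ (Mʳ p) = Mʳ (⊑-trans χ⊑ψ p)
  ⊑-trans χ⊑ψ (Rˡ p) = Rˡ (⊑-trans χ⊑ψ p)
  ⊑-trans χ⊑ψ (Rʳ p) = Rʳ (⊑-trans χ⊑ψ p)

  BoolOver : LTL k → LTL k → Set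
  BoolOver φ tt       = ⊤
  BoolOver φ ff       = ⊤
  BoolOver φ (ψ ∧ᴸ χ) = BoolOver φ ψ × BoolOver φ χ
  BoolOver φ (ψ ∨ᴸ χ) = BoolOver φ ψ × BoolOver φ χ
  BoolOver φ χ        = χ ⊑ φ

  ⊑⇒BoolOver : ∀ {φ} ψ → ψ ⊑ φ → BoolOver φ ψ
  ⊑⇒BoolOver tt       _ = tt
  ⊑⇒BoolOver ff       _ = tt
  ⊑⇒BoolOver (ψ ∧ᴸ χ) p = ⊑⇒BoolOver ψ (⊑-trans (∧ˡ here) p) , ⊑⇒BoolOver χ (⊑-trans (∧ʳ here) p)
  ⊑⇒BoolOver (ψ ∨ᴸ χ) p = ⊑⇒BoolOver ψ (⊑-trans (∨ˡ here) p) , ⊑⇒BoolOver χ (⊑-trans (∨ʳ here) p)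
  ⊑⇒BoolOver (atom _)  p = p
  ⊑⇒BoolOver (natom _) p = p
  ⊑⇒BoolOver (X _)     p = p
  ⊑⇒BoolOver (F _)     p = p
  ⊑⇒BoolOver (G _)     p = p
  ⊑⇒BoolOver (_ U _)   p = p
  ⊑⇒BoolOver (_ W _)   p = p
  ⊑⇒BoolOver (_ M _)   p = p
  ⊑⇒BoolOver (_ R _)   p = p

  af-BoolOver : ∀ {φ} ψ ν → BoolOver φ ψ → BoolOver φ (af ψ ν)
  af-operand : ∀ {φ χ} ψ ν → ψ ⊑ χ → χ ⊑ φ → BoolOver φ (af ψ ν)

  af-BoolOver tt        ν _ = tt
  af-BoolOver ff        ν _ = tt
  af-BoolOver (atom a)  ν _ with ν a
  ... | true  = tt
  ... | false = tt
  af-BoolOver (natom a) ν _ with ν a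
  ... | true  = tt
  ... | false = tt
  af-BoolOver (ψ ∧ᴸ χ) ν (p , q) = af-BoolOver ψ ν p , af-BoolOver χ ν q
  af-BoolOver (ψ ∨ᴸ χ) ν (p , q) = af-BoolOver ψ ν p , af-BoolOver χ ν q
  af-BoolOver (X ψ)    ν p = ⊑⇒BoolOver ψ (⊑-trans (inX here) p)
  af-BoolOver (F ψ)    ν p = af-operand ψ ν (inF here) p , p
  af-BoolOver (G ψ)    ν p = af-operand ψ ν (inG here) p , p
  af-BoolOver (ψ U χ)  ν p = af-operand χ ν (Uʳ here) p , af-operand ψ ν (Uˡ here) p , p
  af-BoolOver (ψ W χ)  ν p = af-operand χ ν (Wʳ here) p , af-operand ψ ν (Wˡ here) p , p
  af-BoolOver (ψ M χ)  ν p = af-operand χ ν (Mʳ here) p , af-operand ψ ν (Mˡ here) p , p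
  af-BoolOver (ψ R χ)  ν p = af-operand χ ν (Rʳ here) p , af-operand ψ ν (Rˡ here) p , p

  af-operand ψ ν ψ⊑χ χ⊑φ = af-BoolOver ψ ν (⊑⇒BoolOver ψ (⊑-trans ψ⊑χ χ⊑φ))

  ProperSubs : LTL k → List (LTL k) → Set
  ProperSubs φ = All (λ χ → ProperSub χ φ)

  dnfC-ProperSubs : ∀ {φ} ψ → BoolOver φ ψ → All (ProperSubs φ) (dnfC ψ)
  dnfC-ProperSubs tt        _ = [] ∷ []
  dnfC-ProperSubs ff        _ = []
  dnfC-ProperSubs (ψ ∧ᴸ χ) (p , q) =
    All-concatMap (λ pc → All-concatMap (λ pd → ++⁺ pc pd ∷ []) (dnfC-ProperSubs χ q))
                  (dnfC-ProperSubs ψ p)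
  dnfC-ProperSubs (ψ ∨ᴸ χ) (p , q) = ++⁺ (dnfC-ProperSubs ψ p) (dnfC-ProperSubs χ q)
  dnfC-ProperSubs (atom _)  p = ((p , tt) ∷ []) ∷ []
  dnfC-ProperSubs (natom _) p = ((p , tt) ∷ []) ∷ []
  dnfC-ProperSubs (X _)     p = ((p , tt) ∷ []) ∷ []
  dnfC-ProperSubs (F _)     p = ((p , tt) ∷ []) ∷ []
  dnfC-ProperSubs (G _)     p = ((p , tt) ∷ []) ∷ []
  dnfC-ProperSubs (_ U _)   p = ((p , tt) ∷ []) ∷ []
  dnfC-ProperSubs (_ W _)   p = ((p , tt) ∷ []) ∷ []
  dnfC-ProperSubs (_ M _)   p = ((p , tt) ∷ []) ∷ []
  dnfC-ProperSubs (_ R _)   p = ((p , tt) ∷ []) ∷ []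

  Clause : LTL k → LTL k → Set
  Clause φ θ = ∃ λ c → θ ≡ conj c × ProperSubs φ c

  conj-BoolOver : ∀ {φ c} → ProperSubs φ c → BoolOver φ (conj c)
  conj-BoolOver []         = tt
  conj-BoolOver (p ∷ pc) = ⊑⇒BoolOver _ (proj₁ p) , conj-BoolOver pc

  Clause⇒BoolOver : ∀ {φ θ} → Clause φ θ → BoolOver φ θ
  Clause⇒BoolOver (_ , refl , pc) = conj-BoolOver pc

  dnf-Clause : ∀ {φ} ψ → BoolOver φ ψ → All (Clause φ) (dnf ψ)
  dnf-Clause ψ p = map⁺ (All.map (λ pc → _ , refl , pc) (dnfC-ProperSubs ψ p))

  af∨-Clause : ∀ {φ} ψ u → BoolOver φ ψ → All (Clause φ) (af∨ ψ u)
  af∨-Clause ψ []          p = dnf-Clause ψ p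
  af∨-Clause ψ (ν ∷ [])    p = dnf-Clause (af ψ ν) (af-BoolOver ψ ν p)
  af∨-Clause ψ (ν ∷ ν′ ∷ u) p =
    All-concatMap (λ cl → af∨-Clause _ (ν′ ∷ u) (Clause⇒BoolOver cl))
                  (dnf-Clause (af ψ ν) (af-BoolOver ψ ν p))

  Reach∨⇒Clause : ∀ {φ θ} → Reach∨ φ θ → ∃ λ c → θ ≡P conj c × ProperSubs φ c
  Reach∨⇒Clause {φ} {θ} (u , θ∈) with lookupAny (af∨-Clause φ u (⊑⇒BoolOver φ here)) θ∈
  ... | (c , eq , pc) , θ≡P = c , subst (θ ≡P_) eq θ≡P , pc

  module _ (ps : List (LTL k)) where

    positions : ∀ {c} → All (_∈ ps) c → List (Fin (length ps))
    positions []       = []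
    positions (m ∷ ms) = index m ∷ positions ms

    lookup-positions : ∀ {c} (ms : All (_∈ ps) c) → map (lookup ps) (positions ms) ≡ c
    lookup-positions []       = refl
    lookup-positions (m ∷ ms) = cong₂ _∷_ (sym (lookup-index m)) (lookup-positions ms)

    positions-⊆ : ∀ {c d} (ms : All (_∈ ps) c) (ns : All (_∈ ps) d) →
      positions ms ⊆ positions ns → c ⊆ d
    positions-⊆ ms ns sub =
      subst₂ _⊆_ (lookup-positions ms) (lookup-positions ns) (Subset.map⁺ (lookup ps) sub)

    ClauseIn : LTL k → Set
    ClauseIn θ = ∃ λ c → θ ≡P conj c × All (_∈ ps) c

    ClauseIn-coding : Coding ClauseIn (2 ^ length ps)
    ClauseIn-coding .code (_ , _ , ms) = funToFin (indicator (positions ms))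
    ClauseIn-coding .code-injective (c , θ≡c , ms) (d , θ′≡d , ns) eq σ =
      trans (θ≡c σ) (trans (conj-cong c⊆d d⊆c σ) (sym (θ′≡d σ)))
      where
      same : indicator (positions ms) ≗ indicator (positions ns)
      same = funToFin-injective _ _ eq
      c⊆d : c ⊆ d
      c⊆d = positions-⊆ ms ns (indicator-⊆ same)
      d⊆c : d ⊆ c
      d⊆c = positions-⊆ ns ms (indicator-⊆ (sym ∘ same))

  Reach∨-coding : ∀ φ ps → (∀ χ → ProperSub χ φ → χ ∈ ps) → Coding (Reach∨ φ) (2 ^ length ps)
  Reach∨-coding φ ps cover = Coding-⊆ ClauseIn-of (ClauseIn-coding ps)
    where
    ClauseIn-of : ∀ θ → Reach∨ φ θ → ClauseIn ps θ
    ClauseIn-of θ r with c , θ≡c , pc ← Reach∨⇒Clause {φ} {θ} r = c , θ≡c , All.map (cover _) pc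

  cover-F : ∀ {φ : LTL k} {ps} → (∀ χ → ProperSub χ φ → χ ∈ ps) →
    ∀ χ → ProperSub χ (F φ) → χ ∈ F φ ∷ ps
  cover-F cover χ (here  , _)  = here refl
  cover-F cover χ (inF p , pr) = there (cover χ (p , pr))

  cover-G : ∀ {φ : LTL k} {ps} → (∀ χ → ProperSub χ φ → χ ∈ ps) →
    ∀ χ → ProperSub χ (G φ) → χ ∈ G φ ∷ ps
  cover-G cover χ (here  , _)  = here refl
  cover-G cover χ (inG p , pr) = there (cover χ (p , pr))

2^[1+n]≡2^[n+1] : ∀ n → 2 ^ suc n ≡ 2 ^ (n + 1)
2^[1+n]≡2^[n+1] n = cong (2 ^_) (+-comm 1 n)

2^[1+n]≤2^[n+1]+1 : ∀ n → 2 ^ suc n ≤ 2 ^ (n + 1) + 1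
2^[1+n]≤2^[n+1]+1 n = ≤-trans (≤-reflexive (2^[1+n]≡2^[n+1] n)) (m≤m+n _ 1)

2^n≤2^[n+1]+1 : ∀ n → 2 ^ n ≤ 2 ^ (n + 1) + 1
2^n≤2^[n+1]+1 n = ≤-trans (m≤m+n (2 ^ n) _) (2^[1+n]≤2^[n+1]+1 n)

proposition7p3 : ∀ {k : ℕ} (φ : LTL k) (ps : List (LTL k)) →
    Unique ps → (∀ χ → (χ ∈ ps) ⇔ ProperSub χ φ) →
    CardLe (Reach∨ φ) (2 ^ length ps)
    × (IsMu φ → CardLe (StatesAμ φ) (2 ^ (length ps + 1) + 1)
                × CardLe (StatesAGFμ φ) (2 ^ (length ps + 1) + 1))
    × (IsNu φ → CardLe (StatesAν φ) (2 ^ (length ps + 1) + 1)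
                × CardLe (StatesAFGν φ) (2 ^ (length ps + 1) + 1))
proposition7p3 φ ps _ ps⇔ =
    Coding⇒CardLe reach
  , (λ _ → Coding⇒CardLe (Coding-≤ (2^n≤2^[n+1]+1 n) reach)
         , Coding⇒CardLe (Coding-≤ (2^[1+n]≤2^[n+1]+1 n) reachF))
  , (λ _ → Coding⇒CardLe (Coding-≤ (2^n≤2^[n+1]+1 n) reach)
         , Coding⇒CardLe (Coding-≤ (≤-reflexive (cong (_+ 1) (2^[1+n]≡2^[n+1] n))) reachFG))
  where
  n : ℕ
  n = length ps
  cover : ∀ χ → ProperSub χ φ → χ ∈ ps
  cover χ = Equivalence.from (ps⇔ χ)
  reach : Coding (Reach∨ φ) (2 ^ n)
  reach = Reach∨-coding φ ps cover
  reachF : Coding (Reach∨ (F φ)) (2 ^ suc n)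
  reachF = Reach∨-coding (F φ) (F φ ∷ ps) (cover-F cover)
  reachFG : Coding (StatesAFGν φ) (2 ^ suc n + 1)
  reachFG = Coding-∪ (Reach∨-coding (G φ) (G φ ∷ ps) (cover-G cover)) (Coding-≡P (F (G φ)))
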